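{- Let $\mathcal X$ be a finite metric space with metric $d$ taking values in $\{0,1,\dots,n\}$, $n=\operatorname{diam}(\mathcal X)$, such that $|B(x,t)|$ does not depend on $x$. Let $Z=\{z_1,\dots,z_N\}\subset\mathcal X$, let $g_0,\dots,g_n\ge0$, and $\gamma(t)=\sum_{i=t}^n g_i$. Then $$D_G^{L_2}(Z)=\langle\lambda_G\rangle_{\mathcal X}-\langle\lambda_G\rangle_Z,$$ where $\lambda_G(x,y)=\frac12\sum_{z\in\mathcal X}|\gamma(d(x,z))-\gamma(d(y,z))|$, $\langle\lambda_G\rangle_{\mathcal X}=\frac1{|\mathcal X|^2}\sum_{x,y\in\mathcal X}\lambda_G(x,y)$ and $\langle\lambda_G\rangle_Z=\frac1{N^2}\sum_{i,j=1}^N\lambda_G(z_i,z_j)$.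
   Context: $B(x,t)=\{y\in\mathcal X:d(x,y)\le t\}$. $D_G^{L_2}(Z)=\sum_{t=0}^n g_tD_t(Z)^2$ with $D_t(Z)^2=\sum_{x\in\mathcal X}\Big(\frac1N\sum_{j=1}^N\mathbb 1_{B(x,t)}(z_j)-\frac{|B(x,t)|}{|\mathcal X|}\Big)^2$.
   Formalization: The weights $g_0,\dots,g_n$ are rational instead of real. -}

module Defs where

open import Data.Nat as ℕ using (ℕ; zero; suc; _≤?_)
open import Data.Fin using (Fin; zero; suc; toℕ)
open import Data.Integer using (+_)
open import Data.Rational using (ℚ; 0ℚ; 1ℚ; _+_; _*_; _-_; _/_; ∣_∣; ½)
open import Relation.Nullary using (yes; no)

sumFin : (k : ℕ) → (Fin k → ℚ) → ℚ
sumFin zero    f = 0ℚ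
sumFin (suc k) f = f zero + sumFin k (λ i → f (suc i))

ℕtoℚ : ℕ → ℚ
ℕtoℚ k = + k / 1

module _ {m : ℕ} (d : Fin m → Fin m → ℕ) where

  ballInd : Fin m → ℕ → Fin m → ℚ
  ballInd x t y with d x y ≤? t
  ... | yes _ = 1ℚ
  ... | no  _ = 0ℚ

  ballSize : Fin m → ℕ → ℚ
  ballSize x t = sumFin m (ballInd x t)

  module _ .{{_ : ℕ.NonZero m}} where

    Dt² : (N : ℕ) → .{{ℕ.NonZero N}} → (Fin N → Fin m) → ℕ → ℚ
    Dt² N z t = sumFin m (λ x →
      let e = ((+ 1) / N) * sumFin N (λ j → ballInd x t (z j))
                - ballSize x t * ((+ 1) / m)
      in e * e)

    DGL2 : (n : ℕ) → (Fin (suc n) → ℚ) →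
           (N : ℕ) → .{{ℕ.NonZero N}} → (Fin N → Fin m) → ℚ
    DGL2 n g N z = sumFin (suc n) (λ t → g t * Dt² N z (toℕ t))

  γ : (n : ℕ) → (Fin (suc n) → ℚ) → ℕ → ℚ
  γ n g t = sumFin (suc n) (λ i → sel (t ≤? toℕ i) (g i))
    where
    sel : ∀ {P : Set} → Relation.Nullary.Dec P → ℚ → ℚ
    sel (yes _) q = q
    sel (no _)  q = 0ℚ

  λG : (n : ℕ) → (Fin (suc n) → ℚ) → Fin m → Fin m → ℚ
  λG n g x y = ½ * sumFin m (λ w → ∣ γ n g (d x w) - γ n g (d y w) ∣)

  avgX : .{{ℕ.NonZero m}} → (n : ℕ) → (Fin (suc n) → ℚ) → ℚ
  avgX n g = ((+ 1) / m) * ((+ 1) / m) * sumFin m (λ x → sumFin m (λ y → λG n g x y))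

  avgZ : (n : ℕ) → (Fin (suc n) → ℚ) →
         (N : ℕ) → .{{ℕ.NonZero N}} → (Fin N → Fin m) → ℚ
  avgZ n g N z = ((+ 1) / N) * ((+ 1) / N) *
    sumFin N (λ i → sumFin N (λ j → λG n g (z i) (z j)))

{-# OPTIONS --safe #-}
module Submission where

-- Fix t and let c(x) = |Z ∩ B(x,t)| / N. All balls of radius t have the same size b, so
-- Σₓ c(x) = b for every Z, and expanding the square gives D_t(Z)² = Σₓ c(x)² − κ_t with κ_t
-- independent of Z. Since uv = (u + v)/2 − |u − v|/2 for u, v ∈ {0,1},
--   Σₓ c(x)² = ⟨|B(a,t) ∩ B(b,t)|⟩_Z = b − ⟨μ_t⟩_Z,   where μ_t(a,b) = ½ |B(a,t) Δ B(b,t)|,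
-- so D_t(Z)² + ⟨μ_t⟩_Z does not depend on Z; taking Z = 𝒳, where the discrepancy vanishes, it
-- equals ⟨μ_t⟩_𝒳. Summing against g gives the theorem because Σ_t g_t μ_t = λ_G: for g ≥ 0 and
-- p ≤ q all differences 1[p ≤ i] − 1[q ≤ i] are ≥ 0, so Σᵢ gᵢ |1[p ≤ i] − 1[q ≤ i]| = |γ(p) − γ(q)|.

module BallDiscrepancy where

  open import Defs
  open import Algebra.Bundles using (CommutativeMonoid)
  open import Data.Fin as Fin using (Fin; toℕ)
  open import Data.Integer as ℤ using (+_)
  import Data.Integer.Properties as ℤ
  open import Data.Nat as ℕ using (ℕ; zero; suc; NonZero; _≤?_)
  open import Data.Nat.Coprimality using (Coprime; 1-coprimeTo) renaming (sym to coprime-sym)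
  import Data.Nat.Properties as ℕ
  open import Data.Product using (Σ; ∃; _×_; _,_)
  open import Data.Rational
    using (ℚ; 0ℚ; 1ℚ; _+_; _*_; _-_; _/_; ∣_∣; ½; mkℚ; 1/_; _≤_; nonNegative)
  open import Data.Rational.Properties
    using ( _≟_; +-*-commutativeRing; +-0-abelianGroup; +-0-commutativeMonoid
          ; /-cong; normalize-coprime; *-inverseˡ; +-identityˡ; +-inverseʳ
          ; *-identityˡ; *-identityʳ; *-zeroˡ; *-zeroʳ; *-assoc; *-comm; *-distribˡ-+; *-distribʳ-+
          ; ≤-refl; +-mono-≤; nonNegative⁻¹; nonNeg*nonNeg⇒nonNeg; ∣-p∣≡∣p∣; 0≤∣p∣; 0≤p⇒∣p∣≡p )
  open import Data.Sum using (inj₁; inj₂)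
  open import Function using (_∘_; _∋_)
  open import Level using (0ℓ)
  open import Relation.Binary.PropositionalEquality
  open import Relation.Nullary using (Dec; yes; no; ¬_; contradiction)
  open import Relation.Nullary.Decidable using (dec⇒maybe)
  open import Tactic.RingSolver using (solve-∀)
  import Tactic.RingSolver.Core.AlmostCommutativeRing as ACR
  open import Algebra.Properties.AbelianGroup +-0-abelianGroup
    using (x≈z//y; ∙-cancelʳ; ⁻¹-anti-homo‿-)
  open import Algebra.Properties.CommutativeSemigroup
    (CommutativeMonoid.commutativeSemigroup +-0-commutativeMonoid)
    using (interchange; xy∙z≈xz∙y)
  open ≡-Reasoning

  ℚ-ring : ACR.AlmostCommutativeRing 0ℓ 0ℓ
  ℚ-ring = ACR.fromCommutativeRing +-*-commutativeRing (λ q → dec⇒maybe (0ℚ ≟ q))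

  ∣p-q∣≡∣q-p∣ : ∀ p q → ∣ p - q ∣ ≡ ∣ q - p ∣
  ∣p-q∣≡∣q-p∣ p q = trans (sym (∣-p∣≡∣p∣ (p - q))) (cong ∣_∣ (⁻¹-anti-homo‿- p q))

  ∣p+q-p∣≡q : ∀ p {q} → 0ℚ ≤ q → ∣ p + q - p ∣ ≡ q
  ∣p+q-p∣≡q p {q} 0≤q = trans (cong ∣_∣ (p+q-p≡q p q)) (0≤p⇒∣p∣≡p 0≤q)
    where
    p+q-p≡q : ∀ p q → p + q - p ≡ q
    p+q-p≡q = solve-∀ ℚ-ring

  0≤p*q : ∀ {p q} → 0ℚ ≤ p → 0ℚ ≤ q → 0ℚ ≤ p * q
  0≤p*q {p} {q} 0≤p 0≤q =
    nonNegative⁻¹ (p * q) {{nonNeg*nonNeg⇒nonNeg p {{nonNegative 0≤p}} q {{nonNegative 0≤q}}}}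

  ℕtoℚ-suc : ∀ k → ℕtoℚ (suc k) ≡ 1ℚ + ℕtoℚ k
  ℕtoℚ-suc k = begin
    + suc k / 1
      ≡⟨ /-cong {+ suc k} (cong (ℤ._+_ (+ 1)) (sym (ℤ.*-identityʳ (+ k)))) refl ⟩
    1ℚ + mkℚ (+ k) 0 k-coprime-1
      ≡⟨ cong (λ q → 1ℚ + q) (normalize-coprime k-coprime-1) ⟨
    1ℚ + ℕtoℚ k
      ∎
    where
    k-coprime-1 : Coprime k 1
    k-coprime-1 = coprime-sym (1-coprimeTo k)

  1/n*n≡1 : ∀ n .{{_ : NonZero n}} → (+ 1 / n) * ℕtoℚ n ≡ 1ℚ
  1/n*n≡1 n@(suc _) = begin
    (+ 1 / n) * ℕtoℚ n
      ≡⟨ cong₂ _*_ (normalize-coprime (1-coprimeTo n)) (normalize-coprime n-coprime-1) ⟩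
    1/ n′ * n′
      ≡⟨ *-inverseˡ n′ ⟩
    1ℚ
      ∎
    where
    n-coprime-1 : Coprime n 1
    n-coprime-1 = coprime-sym (1-coprimeTo n)
    n′ : ℚ
    n′ = mkℚ (+ n) 0 n-coprime-1

  sumFin-cong : ∀ k {f h : Fin k → ℚ} → f ≗ h → sumFin k f ≡ sumFin k h
  sumFin-cong zero    f≗h = refl
  sumFin-cong (suc k) f≗h = cong₂ _+_ (f≗h Fin.zero) (sumFin-cong k (f≗h ∘ Fin.suc))

  sumFin-zero : ∀ k → sumFin k (λ _ → 0ℚ) ≡ 0ℚ
  sumFin-zero zero    = refl
  sumFin-zero (suc k) = trans (cong (_+_ 0ℚ) (sumFin-zero k)) (+-identityˡ 0ℚ)

  sumFin-distrib-+ : ∀ k (f h : Fin k → ℚ) →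
    sumFin k (λ i → f i + h i) ≡ sumFin k f + sumFin k h
  sumFin-distrib-+ zero    f h = refl
  sumFin-distrib-+ (suc k) f h = trans
    (cong (_+_ (f Fin.zero + h Fin.zero)) (sumFin-distrib-+ k (f ∘ Fin.suc) (h ∘ Fin.suc)))
    (interchange (f Fin.zero) (h Fin.zero) _ _)

  *-distribˡ-sumFin : ∀ k c (f : Fin k → ℚ) → c * sumFin k f ≡ sumFin k (λ i → c * f i)
  *-distribˡ-sumFin zero    c f = *-zeroʳ c
  *-distribˡ-sumFin (suc k) c f = trans
    (*-distribˡ-+ c (f Fin.zero) _)
    (cong (_+_ (c * f Fin.zero)) (*-distribˡ-sumFin k c (f ∘ Fin.suc)))

  sumFin-comm : ∀ k l (f : Fin k → Fin l → ℚ) →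
    sumFin k (λ i → sumFin l (f i)) ≡ sumFin l (λ j → sumFin k (λ i → f i j))
  sumFin-comm zero    l f = sym (sumFin-zero l)
  sumFin-comm (suc k) l f = trans
    (cong (_+_ (sumFin l (f Fin.zero))) (sumFin-comm k l (f ∘ Fin.suc)))
    (sym (sumFin-distrib-+ l (f Fin.zero) _))

  sumFin-nonneg : ∀ k {f : Fin k → ℚ} → (∀ i → 0ℚ ≤ f i) → 0ℚ ≤ sumFin k f
  sumFin-nonneg zero    _   = ≤-refl
  sumFin-nonneg (suc k) f≥0 = +-mono-≤ (f≥0 Fin.zero) (sumFin-nonneg k (f≥0 ∘ Fin.suc))

  sumFin-const : ∀ k c → sumFin k (λ _ → c) ≡ ℕtoℚ k * c
  sumFin-const zero    c = sym (*-zeroˡ c)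
  sumFin-const (suc k) c = begin
    c + sumFin k (λ _ → c)  ≡⟨ cong₂ _+_ (sym (*-identityˡ c)) (sumFin-const k c) ⟩
    1ℚ * c + ℕtoℚ k * c     ≡⟨ *-distribʳ-+ c 1ℚ (ℕtoℚ k) ⟨
    (1ℚ + ℕtoℚ k) * c       ≡⟨ cong (_* c) (ℕtoℚ-suc k) ⟨
    ℕtoℚ (suc k) * c        ∎

  average-const : ∀ n .{{_ : NonZero n}} c → (+ 1 / n) * sumFin n (λ _ → c) ≡ c
  average-const n c = begin
    (+ 1 / n) * sumFin n (λ _ → c)  ≡⟨ cong (_*_ (+ 1 / n)) (sumFin-const n c) ⟩
    (+ 1 / n) * (ℕtoℚ n * c)        ≡⟨ *-assoc (+ 1 / n) (ℕtoℚ n) c ⟨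
    (+ 1 / n) * ℕtoℚ n * c          ≡⟨ cong (_* c) (1/n*n≡1 n) ⟩
    1ℚ * c                          ≡⟨ *-identityˡ c ⟩
    c                               ∎

  sumFin-sumFin-distrib-+ : ∀ k l (f h : Fin k → Fin l → ℚ) →
    sumFin k (λ i → sumFin l (λ j → f i j + h i j))
      ≡ sumFin k (λ i → sumFin l (f i)) + sumFin k (λ i → sumFin l (h i))
  sumFin-sumFin-distrib-+ k l f h =
    trans (sumFin-cong k (λ i → sumFin-distrib-+ l (f i) (h i))) (sumFin-distrib-+ k _ _)

  *-distribˡ-sumFin-sumFin : ∀ k l c (f : Fin k → Fin l → ℚ) →
    c * sumFin k (λ i → sumFin l (f i)) ≡ sumFin k (λ i → sumFin l (λ j → c * f i j))
  *-distribˡ-sumFin-sumFin k l c f =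
    trans (*-distribˡ-sumFin k c _) (sumFin-cong k (λ i → *-distribˡ-sumFin l c (f i)))

  sumFin-*-sumFin : ∀ k l (f : Fin k → ℚ) (h : Fin l → ℚ) →
    sumFin k f * sumFin l h ≡ sumFin k (λ i → sumFin l (λ j → f i * h j))
  sumFin-*-sumFin k l f h = begin
    sumFin k f * sumFin l h
      ≡⟨ *-comm (sumFin k f) (sumFin l h) ⟩
    sumFin l h * sumFin k f
      ≡⟨ *-distribˡ-sumFin k (sumFin l h) f ⟩
    sumFin k (λ i → sumFin l h * f i)
      ≡⟨ sumFin-cong k (λ i → *-comm (sumFin l h) (f i)) ⟩
    sumFin k (λ i → f i * sumFin l h)
      ≡⟨ sumFin-cong k (λ i → *-distribˡ-sumFin l (f i) h) ⟩
    sumFin k (λ i → sumFin l (λ j → f i * h j))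
      ∎

  sumFin-squared-deviation : ∀ k (f : Fin k → ℚ) c →
    sumFin k (λ x → (f x - c) * (f x - c)) + (c + c) * sumFin k f
      ≡ sumFin k (λ x → f x * f x) + sumFin k (λ _ → c * c)
  sumFin-squared-deviation k f c = begin
    deviation² + (c + c) * sumFin k f
      ≡⟨ cong (_+_ deviation²) (*-distribˡ-sumFin k (c + c) f) ⟩
    deviation² + sumFin k (λ x → (c + c) * f x)
      ≡⟨ sumFin-distrib-+ k _ _ ⟨
    sumFin k (λ x → (f x - c) * (f x - c) + (c + c) * f x)
      ≡⟨ sumFin-cong k (λ x → expand (f x) c) ⟩
    sumFin k (λ x → f x * f x + c * c)
      ≡⟨ sumFin-distrib-+ k _ _ ⟩
    sumFin k (λ x → f x * f x) + sumFin k (λ _ → c * c)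
      ∎
    where
    deviation² : ℚ
    deviation² = sumFin k (λ x → (f x - c) * (f x - c))
    expand : ∀ p c → (p - c) * (p - c) + (c + c) * p ≡ p * p + c * c
    expand = solve-∀ ℚ-ring

  -- The paper's ⟨K⟩_Z: avgZ d n g is mean (λG d n g) and avgX d n g is mean (λG d n g) m id.
  mean : ∀ {A : Set} → (A → A → ℚ) → (n : ℕ) → .{{NonZero n}} → (Fin n → A) → ℚ
  mean K n z = (+ 1 / n) * (+ 1 / n) * sumFin n (λ i → sumFin n (λ j → K (z i) (z j)))

  module _ {A : Set} (n : ℕ) .{{_ : NonZero n}} (z : Fin n → A) where

    private
      u : ℚ
      u = + 1 / n

    mean-cong : ∀ {K L : A → A → ℚ} → (∀ a b → K a b ≡ L a b) → mean K n z ≡ mean L n z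
    mean-cong K≗L =
      cong (_*_ (u * u)) (sumFin-cong n (λ i → sumFin-cong n (λ j → K≗L (z i) (z j))))

    mean-const : ∀ c → mean (λ _ _ → c) n z ≡ c
    mean-const c = begin
      u * u * sumFin n (λ _ → sumFin n (λ _ → c))    ≡⟨ *-assoc u u _ ⟩
      u * (u * sumFin n (λ _ → sumFin n (λ _ → c)))  ≡⟨ cong (_*_ u) (average-const n _) ⟩
      u * sumFin n (λ _ → c)                         ≡⟨ average-const n c ⟩
      c                                              ∎

    mean-+ : ∀ K L → mean K n z + mean L n z ≡ mean (λ a b → K a b + L a b) n z
    mean-+ K L = trans (sym (*-distribˡ-+ (u * u) _ _)) (cong (_*_ (u * u)) (sym
      (sumFin-sumFin-distrib-+ n n (λ i j → K (z i) (z j)) (λ i j → L (z i) (z j)))))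

    sumFin-*-mean : ∀ k (w : Fin k → ℚ) (K : Fin k → A → A → ℚ) →
      sumFin k (λ t → w t * mean (K t) n z) ≡ mean (λ a b → sumFin k (λ t → w t * K t a b)) n z
    sumFin-*-mean k w K = begin
      sumFin k (λ t → w t * (u * u * S t))
        ≡⟨ sumFin-cong k (λ t → w*[c*s]≡c*[w*s] (w t) (u * u) (S t)) ⟩
      sumFin k (λ t → u * u * (w t * S t))
        ≡⟨ *-distribˡ-sumFin k (u * u) _ ⟨
      u * u * sumFin k (λ t → w t * S t)
        ≡⟨ cong (_*_ (u * u)) (sumFin-cong k (λ t → *-distribˡ-sumFin-sumFin n n (w t) (K′ t))) ⟩
      u * u * sumFin k (λ t → sumFin n (λ i → sumFin n (λ j → w t * K′ t i j)))
        ≡⟨ cong (_*_ (u * u)) (sumFin-comm k n _) ⟩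
      u * u * sumFin n (λ i → sumFin k (λ t → sumFin n (λ j → w t * K′ t i j)))
        ≡⟨ cong (_*_ (u * u)) (sumFin-cong n (λ i → sumFin-comm k n _)) ⟩
      u * u * sumFin n (λ i → sumFin n (λ j → sumFin k (λ t → w t * K′ t i j)))
        ∎
      where
      K′ : Fin k → Fin n → Fin n → ℚ
      K′ t i j = K t (z i) (z j)
      S : Fin k → ℚ
      S t = sumFin n (λ i → sumFin n (K′ t i))
      w*[c*s]≡c*[w*s] : ∀ w c s → w * (c * s) ≡ c * (w * s)
      w*[c*s]≡c*[w*s] = solve-∀ ℚ-ring

  𝟙 : ∀ {P : Set} → Dec P → ℚ
  𝟙 (yes _) = 1ℚ
  𝟙 (no _)  = 0ℚ

  𝟙*𝟙+½∣𝟙-𝟙∣ : ∀ {P Q : Set} (D : Dec P) (E : Dec Q) →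
    𝟙 D * 𝟙 E + ½ * ∣ 𝟙 D - 𝟙 E ∣ ≡ ½ * (𝟙 D + 𝟙 E)
  𝟙*𝟙+½∣𝟙-𝟙∣ (yes _) (yes _) = refl
  𝟙*𝟙+½∣𝟙-𝟙∣ (yes _) (no _)  = refl
  𝟙*𝟙+½∣𝟙-𝟙∣ (no _)  (yes _) = refl
  𝟙*𝟙+½∣𝟙-𝟙∣ (no _)  (no _)  = refl

  𝟙-split : ∀ {P Q : Set} (D : Dec P) (E : Dec Q) → (Q → P) → 𝟙 D ≡ 𝟙 E + ∣ 𝟙 D - 𝟙 E ∣
  𝟙-split (yes _) (yes _) _   = refl
  𝟙-split (yes _) (no _)  _   = refl
  𝟙-split (no ¬p) (yes q) q⇒p = contradiction (q⇒p q) ¬p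
  𝟙-split (no _)  (no _)  _   = refl

  nested-∣sumFin-sumFin∣ : ∀ k (w : Fin k → ℚ) → (∀ i → 0ℚ ≤ w i) →
    {P Q : Fin k → Set} (D : ∀ i → Dec (P i)) (E : ∀ i → Dec (Q i)) → (∀ i → Q i → P i) →
    ∣ sumFin k (λ i → w i * 𝟙 (D i)) - sumFin k (λ i → w i * 𝟙 (E i)) ∣
      ≡ sumFin k (λ i → w i * ∣ 𝟙 (D i) - 𝟙 (E i) ∣)
  nested-∣sumFin-sumFin∣ k w w≥0 D E Q⇒P = begin
    ∣ sumFin k (λ i → w i * 𝟙 (D i)) - ΣE ∣  ≡⟨ cong (λ s → ∣ s - ΣE ∣) ΣD≡ΣE+ΣΔ ⟩
    ∣ ΣE + ΣΔ - ΣE ∣                         ≡⟨ ∣p+q-p∣≡q ΣE ΣΔ≥0 ⟩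
    ΣΔ                                       ∎
    where
    Δ : Fin k → ℚ
    Δ i = ∣ 𝟙 (D i) - 𝟙 (E i) ∣
    ΣE ΣΔ : ℚ
    ΣE = sumFin k (λ i → w i * 𝟙 (E i))
    ΣΔ = sumFin k (λ i → w i * Δ i)
    ΣΔ≥0 : 0ℚ ≤ ΣΔ
    ΣΔ≥0 = sumFin-nonneg k (λ i → 0≤p*q (w≥0 i) (0≤∣p∣ _))
    ΣD≡ΣE+ΣΔ : sumFin k (λ i → w i * 𝟙 (D i)) ≡ ΣE + ΣΔ
    ΣD≡ΣE+ΣΔ = trans
      (sumFin-cong k (λ i → trans (cong (_*_ (w i)) (𝟙-split (D i) (E i) (Q⇒P i)))
                                  (*-distribˡ-+ (w i) (𝟙 (E i)) (Δ i))))
      (sumFin-distrib-+ k _ _)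

  module _ {m : ℕ} (d : Fin m → Fin m → ℕ) (n : ℕ) (g : Fin (suc n) → ℚ) where

    -- γ selects its summands with a function local to its where-block in Defs, which cannot
    -- be named here. Abstracting the ingredients of the first summand makes its equation a
    -- pattern-unification problem, whose solution is that function.
    private
      Selector : Set₁
      Selector = (P : Set) → Dec P → ℚ → ℚ

      γ-selector : ∀ p → ∃ λ (select : Selector) →
        (∀ {P : Set} (x : P) q → select P (yes x) q ≡ q) ×
        (∀ {P : Set} (¬x : ¬ P) q → select P (no ¬x) q ≡ 0ℚ) ×
        γ d n g p ≡ sumFin (suc n) (λ i → select _ (p ≤? toℕ i) (g i))
      γ-selector p with Σ Selector (_≡_ _) ∋ (_ , refl) | _+_ | p ℕ.≤ 0 | p ≤? 0 | g Fin.zero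
      ... | select , refl | _ | _ | _ | _ = select , (λ _ _ → refl) , (λ _ _ → refl) , refl

    γ≡sumFin-𝟙 : ∀ p → γ d n g p ≡ sumFin (suc n) (λ i → g i * 𝟙 (p ≤? toℕ i))
    γ≡sumFin-𝟙 p with γ-selector p
    ... | select , select-yes , select-no , γ≡ =
      trans γ≡ (sumFin-cong (suc n) (λ i → selected (p ≤? toℕ i) (g i)))
      where
      selected : ∀ {P : Set} (D : Dec P) q → select P D q ≡ q * 𝟙 D
      selected (yes x) q = trans (select-yes x q) (sym (*-identityʳ q))
      selected (no ¬x) q = trans (select-no ¬x q) (sym (*-zeroʳ q))

    module _ (g≥0 : ∀ i → 0ℚ ≤ g i) where

      ∣γ-γ∣-≤ : ∀ {p q} → p ℕ.≤ q → ∣ γ d n g p - γ d n g q ∣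
                  ≡ sumFin (suc n) (λ i → g i * ∣ 𝟙 (p ≤? toℕ i) - 𝟙 (q ≤? toℕ i) ∣)
      ∣γ-γ∣-≤ {p} {q} p≤q = trans
        (cong₂ (λ a b → ∣ a - b ∣) (γ≡sumFin-𝟙 p) (γ≡sumFin-𝟙 q))
        (nested-∣sumFin-sumFin∣ (suc n) g g≥0 (λ i → p ≤? toℕ i) (λ i → q ≤? toℕ i)
                                (λ _ → ℕ.≤-trans p≤q))

      ∣γ-γ∣ : ∀ p q → ∣ γ d n g p - γ d n g q ∣
                ≡ sumFin (suc n) (λ i → g i * ∣ 𝟙 (p ≤? toℕ i) - 𝟙 (q ≤? toℕ i) ∣)
      ∣γ-γ∣ p q with ℕ.≤-total p q
      ... | inj₁ p≤q = ∣γ-γ∣-≤ p≤q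
      ... | inj₂ q≤p = begin
        ∣ γ d n g p - γ d n g q ∣
          ≡⟨ ∣p-q∣≡∣q-p∣ (γ d n g p) (γ d n g q) ⟩
        ∣ γ d n g q - γ d n g p ∣
          ≡⟨ ∣γ-γ∣-≤ q≤p ⟩
        sumFin (suc n) (λ i → g i * ∣ 𝟙 (q ≤? toℕ i) - 𝟙 (p ≤? toℕ i) ∣)
          ≡⟨ sumFin-cong (suc n) (λ i → cong (_*_ (g i))
               (∣p-q∣≡∣q-p∣ (𝟙 (q ≤? toℕ i)) (𝟙 (p ≤? toℕ i)))) ⟩
        sumFin (suc n) (λ i → g i * ∣ 𝟙 (p ≤? toℕ i) - 𝟙 (q ≤? toℕ i) ∣)
          ∎

  module _ {m : ℕ} (d : Fin m → Fin m → ℕ) where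

    ballInd≡𝟙 : ∀ a t x → ballInd d a t x ≡ 𝟙 (d a x ≤? t)
    ballInd≡𝟙 a t x with d a x ≤? t
    ... | yes _ = refl
    ... | no _  = refl

    ballOverlap : ℕ → Fin m → Fin m → ℚ
    ballOverlap t a b = sumFin m (λ x → ballInd d a t x * ballInd d b t x)

    -- λG d n g for g the indicator of t, i.e. half the size of B(a,t) Δ B(b,t).
    halfBallSymDiff : ℕ → Fin m → Fin m → ℚ
    halfBallSymDiff t a b = ½ * sumFin m (λ x → ∣ ballInd d a t x - ballInd d b t x ∣)

    ballOverlap+halfBallSymDiff : ∀ t a b →
      ballOverlap t a b + halfBallSymDiff t a b ≡ ½ * (ballSize d a t + ballSize d b t)
    ballOverlap+halfBallSymDiff t a b = begin
      ballOverlap t a b + ½ * sumFin m (λ x → ∣ I a x - I b x ∣)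
        ≡⟨ cong (_+_ (ballOverlap t a b)) (*-distribˡ-sumFin m ½ (λ x → ∣ I a x - I b x ∣)) ⟩
      ballOverlap t a b + sumFin m (λ x → ½ * ∣ I a x - I b x ∣)
        ≡⟨ sumFin-distrib-+ m _ _ ⟨
      sumFin m (λ x → I a x * I b x + ½ * ∣ I a x - I b x ∣)
        ≡⟨ sumFin-cong m pointwise ⟩
      sumFin m (λ x → ½ * (I a x + I b x))
        ≡⟨ *-distribˡ-sumFin m ½ (λ x → I a x + I b x) ⟨
      ½ * sumFin m (λ x → I a x + I b x)
        ≡⟨ cong (_*_ ½) (sumFin-distrib-+ m _ _) ⟩
      ½ * (ballSize d a t + ballSize d b t)
        ∎
      where
      I : Fin m → Fin m → ℚ
      I a = ballInd d a t
      pointwise : ∀ x → I a x * I b x + ½ * ∣ I a x - I b x ∣ ≡ ½ * (I a x + I b x)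
      pointwise x rewrite ballInd≡𝟙 a t x | ballInd≡𝟙 b t x =
        𝟙*𝟙+½∣𝟙-𝟙∣ (d a x ≤? t) (d b x ≤? t)

    sumFin-*-halfBallSymDiff≡λG : ∀ n (g : Fin (suc n) → ℚ) → (∀ i → 0ℚ ≤ g i) → ∀ a b →
      sumFin (suc n) (λ t → g t * halfBallSymDiff (toℕ t) a b) ≡ λG d n g a b
    sumFin-*-halfBallSymDiff≡λG n g g≥0 a b = begin
      sumFin (suc n) (λ t → g t * (½ * sumFin m (Δ t)))
        ≡⟨ sumFin-cong (suc n) (λ t → g*[½*s]≡½*[g*s] (g t) (sumFin m (Δ t))) ⟩
      sumFin (suc n) (λ t → ½ * (g t * sumFin m (Δ t)))
        ≡⟨ *-distribˡ-sumFin (suc n) ½ (λ t → g t * sumFin m (Δ t)) ⟨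
      ½ * sumFin (suc n) (λ t → g t * sumFin m (Δ t))
        ≡⟨ cong (_*_ ½) (sumFin-cong (suc n) (λ t → *-distribˡ-sumFin m (g t) (Δ t))) ⟩
      ½ * sumFin (suc n) (λ t → sumFin m (λ x → g t * Δ t x))
        ≡⟨ cong (_*_ ½) (sumFin-comm (suc n) m (λ t x → g t * Δ t x)) ⟩
      ½ * sumFin m (λ x → sumFin (suc n) (λ t → g t * Δ t x))
        ≡⟨ cong (_*_ ½) (sumFin-cong m (λ x → sym (∣γ-γ∣-ball x))) ⟩
      ½ * sumFin m (λ x → ∣ γ d n g (d a x) - γ d n g (d b x) ∣)
        ∎
      where
      Δ : Fin (suc n) → Fin m → ℚ
      Δ t x = ∣ ballInd d a (toℕ t) x - ballInd d b (toℕ t) x ∣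
      g*[½*s]≡½*[g*s] : ∀ g s → g * (½ * s) ≡ ½ * (g * s)
      g*[½*s]≡½*[g*s] = solve-∀ ℚ-ring
      ∣γ-γ∣-ball : ∀ x →
        ∣ γ d n g (d a x) - γ d n g (d b x) ∣ ≡ sumFin (suc n) (λ t → g t * Δ t x)
      ∣γ-γ∣-ball x = trans (∣γ-γ∣ d n g g≥0 (d a x) (d b x)) (sumFin-cong (suc n) (λ t →
        cong (_*_ (g t)) (sym (cong₂ (λ p q → ∣ p - q ∣)
          (ballInd≡𝟙 a (toℕ t) x) (ballInd≡𝟙 b (toℕ t) x)))))

    Dt²-whole-space : .{{_ : NonZero m}} → ∀ t → Dt² d m (λ x → x) t ≡ 0ℚ
    Dt²-whole-space t =
      trans (sumFin-cong m (λ x → cong (λ e → e * e) (deviation-zero x))) (sumFin-zero m)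
      where
      deviation-zero : ∀ x → (+ 1 / m) * ballSize d x t - ballSize d x t * (+ 1 / m) ≡ 0ℚ
      deviation-zero x = trans
        (cong (_- ballSize d x t * (+ 1 / m)) (*-comm (+ 1 / m) (ballSize d x t)))
        (+-inverseʳ (ballSize d x t * (+ 1 / m)))

  module _ {m : ℕ} .{{_ : NonZero m}} (d : Fin m → Fin m → ℕ) (d-sym : ∀ x y → d x y ≡ d y x)
           (ballSize-const : ∀ x y t → ballSize d x t ≡ ballSize d y t) (x₀ : Fin m) where

    ball : ℕ → ℚ
    ball t = ballSize d x₀ t

    ballFraction : ℕ → ℚ
    ballFraction t = ball t * (+ 1 / m)

    -- The fraction of the points of z lying in B(x,t), read off through d-sym as
    -- the number of j with x ∈ B(z j, t).
    coverage : (N : ℕ) → .{{NonZero N}} → (Fin N → Fin m) → ℕ → Fin m → ℚ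
    coverage N z t x = (+ 1 / N) * sumFin N (λ j → ballInd d (z j) t x)

    ballInd-sym : ∀ a t x → ballInd d a t x ≡ ballInd d x t a
    ballInd-sym a t x = begin
      ballInd d a t x  ≡⟨ ballInd≡𝟙 d a t x ⟩
      𝟙 (d a x ≤? t)   ≡⟨ cong (λ r → 𝟙 (r ≤? t)) (d-sym a x) ⟩
      𝟙 (d x a ≤? t)   ≡⟨ ballInd≡𝟙 d x t a ⟨
      ballInd d x t a  ∎

    ballOverlap+halfBallSymDiff≡ball : ∀ t a b →
      ballOverlap d t a b + halfBallSymDiff d t a b ≡ ball t
    ballOverlap+halfBallSymDiff≡ball t a b = begin
      ballOverlap d t a b + halfBallSymDiff d t a b
        ≡⟨ ballOverlap+halfBallSymDiff d t a b ⟩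
      ½ * (ballSize d a t + ballSize d b t)
        ≡⟨ cong₂ (λ p q → ½ * (p + q)) (ballSize-const a x₀ t) (ballSize-const b x₀ t) ⟩
      ½ * (ball t + ball t)
        ≡⟨ ½*[p+p]≡p (ball t) ⟩
      ball t
        ∎
      where
      ½*[p+p]≡p : ∀ p → ½ * (p + p) ≡ p
      ½*[p+p]≡p = solve-∀ ℚ-ring

    module _ (N : ℕ) .{{_ : NonZero N}} (z : Fin N → Fin m) (t : ℕ) where

      private
        u : ℚ
        u = + 1 / N
        c : Fin m → ℚ
        c = coverage N z t
        β : ℚ
        β = ballFraction t

      sumFin-coverage : sumFin m c ≡ ball t
      sumFin-coverage = begin
        sumFin m (λ x → u * sumFin N (λ j → ballInd d (z j) t x))
          ≡⟨ *-distribˡ-sumFin m u _ ⟨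
        u * sumFin m (λ x → sumFin N (λ j → ballInd d (z j) t x))
          ≡⟨ cong (_*_ u) (sumFin-comm m N _) ⟩
        u * sumFin N (λ j → ballSize d (z j) t)
          ≡⟨ cong (_*_ u) (sumFin-cong N (λ j → ballSize-const (z j) x₀ t)) ⟩
        u * sumFin N (λ _ → ball t)
          ≡⟨ average-const N (ball t) ⟩
        ball t
          ∎

      sumFin-coverage² : sumFin m (λ x → c x * c x) ≡ mean (ballOverlap d t) N z
      sumFin-coverage² = begin
        sumFin m (λ x → (u * A x) * (u * A x))
          ≡⟨ sumFin-cong m (λ x → [u*a]*[u*a]≡u*u*[a*a] u (A x)) ⟩
        sumFin m (λ x → u * u * (A x * A x))
          ≡⟨ *-distribˡ-sumFin m (u * u) _ ⟨
        u * u * sumFin m (λ x → A x * A x)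
          ≡⟨ cong (_*_ (u * u)) (sumFin-cong m (λ x → sumFin-*-sumFin N N (I x) (I x))) ⟩
        u * u * sumFin m (λ x → sumFin N (λ i → sumFin N (λ j → I x i * I x j)))
          ≡⟨ cong (_*_ (u * u)) (sumFin-comm m N _) ⟩
        u * u * sumFin N (λ i → sumFin m (λ x → sumFin N (λ j → I x i * I x j)))
          ≡⟨ cong (_*_ (u * u)) (sumFin-cong N (λ i → sumFin-comm m N _)) ⟩
        u * u * sumFin N (λ i → sumFin N (λ j → ballOverlap d t (z i) (z j)))
          ∎
        where
        I : Fin m → Fin N → ℚ
        I x j = ballInd d (z j) t x
        A : Fin m → ℚ
        A x = sumFin N (I x)
        [u*a]*[u*a]≡u*u*[a*a] : ∀ u a → (u * a) * (u * a) ≡ u * u * (a * a)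
        [u*a]*[u*a]≡u*u*[a*a] = solve-∀ ℚ-ring

      sumFin-coverage²+mean≡ball :
        sumFin m (λ x → c x * c x) + mean (halfBallSymDiff d t) N z ≡ ball t
      sumFin-coverage²+mean≡ball = begin
        sumFin m (λ x → c x * c x) + mean (halfBallSymDiff d t) N z
          ≡⟨ cong (_+ mean (halfBallSymDiff d t) N z) sumFin-coverage² ⟩
        mean (ballOverlap d t) N z + mean (halfBallSymDiff d t) N z
          ≡⟨ mean-+ N z (ballOverlap d t) (halfBallSymDiff d t) ⟩
        mean (λ a b → ballOverlap d t a b + halfBallSymDiff d t a b) N z
          ≡⟨ mean-cong N z (ballOverlap+halfBallSymDiff≡ball t) ⟩
        mean (λ _ _ → ball t) N z
          ≡⟨ mean-const N z (ball t) ⟩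
        ball t
          ∎

      Dt²≡sumFin-deviation² : Dt² d N z t ≡ sumFin m (λ x → (c x - β) * (c x - β))
      Dt²≡sumFin-deviation² = sumFin-cong m (λ x → cong (λ e → e * e) (cong₂ _-_
        (cong (_*_ u) (sumFin-cong N (λ j → ballInd-sym x t (z j))))
        (cong (_* (+ 1 / m)) (ballSize-const x x₀ t))))

      Dt²+mean-invariant : Dt² d N z t + mean (halfBallSymDiff d t) N z + (β + β) * ball t
                             ≡ ball t + sumFin m (λ _ → β * β)
      Dt²+mean-invariant = begin
        Dt² d N z t + H + (β + β) * ball t
          ≡⟨ cong₂ (λ D s → D + H + (β + β) * s) Dt²≡sumFin-deviation² (sym sumFin-coverage) ⟩
        deviation² + H + (β + β) * sumFin m c
          ≡⟨ xy∙z≈xz∙y deviation² H _ ⟩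
        deviation² + (β + β) * sumFin m c + H
          ≡⟨ cong (_+ H) (sumFin-squared-deviation m c β) ⟩
        coverage² + sumFin m (λ _ → β * β) + H
          ≡⟨ xy∙z≈xz∙y coverage² _ H ⟩
        coverage² + H + sumFin m (λ _ → β * β)
          ≡⟨ cong (_+ sumFin m (λ _ → β * β)) sumFin-coverage²+mean≡ball ⟩
        ball t + sumFin m (λ _ → β * β)
          ∎
        where
        H deviation² coverage² : ℚ
        H = mean (halfBallSymDiff d t) N z
        deviation² = sumFin m (λ x → (c x - β) * (c x - β))
        coverage² = sumFin m (λ x → c x * c x)

    Dt²+mean≡mean-whole-space : ∀ N .{{_ : NonZero N}} (z : Fin N → Fin m) t →
      Dt² d N z t + mean (halfBallSymDiff d t) N z ≡ mean (halfBallSymDiff d t) m (λ x → x)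
    Dt²+mean≡mean-whole-space N z t = ∙-cancelʳ k _ _ (begin
      Dt² d N z t + mean H N z + k
        ≡⟨ Dt²+mean-invariant N z t ⟩
      ball t + sumFin m (λ _ → β * β)
        ≡⟨ Dt²+mean-invariant m (λ x → x) t ⟨
      Dt² d m (λ x → x) t + mean H m (λ x → x) + k
        ≡⟨ cong (λ D → D + mean H m (λ x → x) + k) (Dt²-whole-space d t) ⟩
      0ℚ + mean H m (λ x → x) + k
        ≡⟨ cong (_+ k) (+-identityˡ (mean H m (λ x → x))) ⟩
      mean H m (λ x → x) + k
        ∎)
      where
      H : Fin m → Fin m → ℚ
      H = halfBallSymDiff d t
      β k : ℚ
      β = ballFraction t
      k = (β + β) * ball t

    module _ (n : ℕ) (g : Fin (suc n) → ℚ) (g≥0 : ∀ i → 0ℚ ≤ g i) where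

      private
        H : Fin (suc n) → Fin m → Fin m → ℚ
        H t = halfBallSymDiff d (toℕ t)

        sumFin-*-mean≡mean-λG : ∀ N .{{_ : NonZero N}} (z : Fin N → Fin m) →
          sumFin (suc n) (λ t → g t * mean (H t) N z) ≡ mean (λG d n g) N z
        sumFin-*-mean≡mean-λG N z = trans
          (sumFin-*-mean N z (suc n) g H)
          (mean-cong N z (sumFin-*-halfBallSymDiff≡λG d n g g≥0))

      DGL2+avgZ≡avgX : ∀ N .{{_ : NonZero N}} (z : Fin N → Fin m) →
        DGL2 d n g N z + avgZ d n g N z ≡ avgX d n g
      DGL2+avgZ≡avgX N z = begin
        DGL2 d n g N z + mean (λG d n g) N z
          ≡⟨ cong (_+_ (DGL2 d n g N z)) (sumFin-*-mean≡mean-λG N z) ⟨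
        DGL2 d n g N z + sumFin (suc n) (λ t → g t * mean (H t) N z)
          ≡⟨ sumFin-distrib-+ (suc n) (λ t → g t * D t) (λ t → g t * mean (H t) N z) ⟨
        sumFin (suc n) (λ t → g t * D t + g t * mean (H t) N z)
          ≡⟨ sumFin-cong (suc n) (λ t → *-distribˡ-+ (g t) (D t) (mean (H t) N z)) ⟨
        sumFin (suc n) (λ t → g t * (D t + mean (H t) N z))
          ≡⟨ sumFin-cong (suc n) (λ t → cong (_*_ (g t)) (Dt²+mean≡mean-whole-space N z (toℕ t))) ⟩
        sumFin (suc n) (λ t → g t * mean (H t) m (λ x → x))
          ≡⟨ sumFin-*-mean≡mean-λG m (λ x → x) ⟩
        mean (λG d n g) m (λ x → x)
          ∎
        where
        D : Fin (suc n) → ℚ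
        D t = Dt² d N z (toℕ t)

      DGL2≡avgX-avgZ : ∀ N .{{_ : NonZero N}} (z : Fin N → Fin m) →
        DGL2 d n g N z ≡ avgX d n g - avgZ d n g N z
      DGL2≡avgX-avgZ N z = x≈z//y _ _ _ (DGL2+avgZ≡avgX N z)


open import Defs
open import Data.Nat using (ℕ; suc; _≤_; _+_; NonZero)
open import Data.Fin using (Fin)
open import Data.Product using (∃₂; _,_)
open import Data.Rational using (ℚ; 0ℚ; _-_) renaming (_≤_ to _≤ℚ_)
open import Relation.Binary.PropositionalEquality using (_≡_)
open import Function.Definitions using (Injective)
open BallDiscrepancy using (DGL2≡avgX-avgZ)

theorem6p1 : (m : ℕ) → .{{_ : NonZero m}} → (d : Fin m → Fin m → ℕ) → (n : ℕ) →
    (∀ x y → d x y ≡ 0 → x ≡ y) → (∀ x → d x x ≡ 0) →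
    (∀ x y → d x y ≡ d y x) → (∀ x y w → d x w ≤ d x y + d y w) →
    (∀ x y → d x y ≤ n) → ∃₂ (λ x y → d x y ≡ n) →
    (∀ x y t → ballSize d x t ≡ ballSize d y t) →
    (N : ℕ) → .{{_ : NonZero N}} → (z : Fin N → Fin m) → Injective _≡_ _≡_ z →
    (g : Fin (suc n) → ℚ) → (∀ i → 0ℚ ≤ℚ g i) →
    DGL2 d n g N z ≡ avgX d n g - avgZ d n g N z
theorem6p1 m d n _ _ d-sym _ _ (x₀ , _ , _) ballSize-const N z _ g g≥0 =
  DGL2≡avgX-avgZ d d-sym ballSize-const x₀ n g g≥0 N z
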